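{- For every $\beta>0$ there exists $\lambda>0$ such that the following holds. For all sufficiently large $n$, every colouring $\psi\colon E(K_n)\to\{\mathrm{red},\mathrm{blue}\}$ satisfying $|\psi^{ -1}(c)|\ge\beta n^2$ for both $c\in\{\mathrm{red},\mathrm{blue}\}$ contains at least $\lambda n^4$ copies of $C_{rrbb}$.
   Context: A copy of $C_{rrbb}$ in a red/blue-coloured graph is a $4$-cycle of the graph having two adjacent red edges and two adjacent blue edges. -}

module Defs where

open import Data.Nat using (ℕ; zero; suc; _+_; _*_; _^_; _<ᵇ_)
open import Data.Bool using (Bool; true; false; _∧_; not)
open import Data.Fin using (Fin; toℕ; _≟_)
open import Data.List using (List; map)
open import Data.Nat.ListAction using (sum)
open import Data.List using (allFin)
open import Relation.Nullary.Decidable using (⌊_⌋)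
open import Relation.Binary.PropositionalEquality using (_≡_)
open import Data.Integer using (+_)
open import Data.Rational using (ℚ; _/_)

data Colour : Set where
  red blue : Colour

_==_ : Colour → Colour → Bool
red  == red  = true
blue == blue = true
_    == _    = false

-- A red/blue colouring of E(K_n), vertex set Fin n: a symmetric function on
-- pairs of vertices (values on the diagonal i = i are irrelevant and ignored).
record EdgeColouring (n : ℕ) : Set where
  field
    col : Fin n → Fin n → Colour
    sym : ∀ i j → col i j ≡ col j i
open EdgeColouring public

ΣFin : (n : ℕ) → (Fin n → ℕ) → ℕ
ΣFin n f = sum (map f (allFin n))

𝟙 : Bool → ℕ
𝟙 true  = 1
𝟙 false = 0

_≠ᵇ_ : ∀ {n} → Fin n → Fin n → Bool
i ≠ᵇ j = not ⌊ i ≟ j ⌋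

edgesOfColour : ∀ {n} → EdgeColouring n → Colour → ℕ
edgesOfColour {n} ψ c =
  ΣFin n λ i → ΣFin n λ j → 𝟙 ((toℕ i <ᵇ toℕ j) ∧ (col ψ i j == c))

-- Number of copies of C_rrbb: 4-cycles a-b-c-d-a of K_n with ab, bc red and
-- cd, da blue.  Each such 4-cycle (as a subgraph) determines b (the vertex
-- between the two red edges) and d (between the two blue edges) uniquely, and
-- {a, c} as an unordered pair; we break that symmetry by requiring a < c.
copiesCrrbb : ∀ {n} → EdgeColouring n → ℕ
copiesCrrbb {n} ψ =
  ΣFin n λ a → ΣFin n λ b → ΣFin n λ c → ΣFin n λ d →
    𝟙 ( (toℕ a <ᵇ toℕ c)
      ∧ (a ≠ᵇ b) ∧ (a ≠ᵇ d) ∧ (b ≠ᵇ c) ∧ (b ≠ᵇ d) ∧ (c ≠ᵇ d)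
      ∧ (col ψ a b == red) ∧ (col ψ b c == red)
      ∧ (col ψ c d == blue) ∧ (col ψ d a == blue))

ℕ→ℚ : ℕ → ℚ
ℕ→ℚ m = (+ m) / 1

-- Let t(b,d) be the number of vertices x with xb red and xd blue. A copy of C_rrbb is a choice
-- of b, d and an unordered pair {a,c} of such vertices, so 2·#copies = Σ t² − Σ t, while
-- Σ t = M := Σ_x r(x)·b(x), r and b being the red and blue degrees; by Cauchy–Schwarz
-- Σ t² ≥ M²/n². To bound M from below, let m := Σ_x min(r(x), b(x)): then (n−1)·m ≤ 2M.
-- Split the vertices into those of red and of blue majority: every edge between the two
-- classes raises a minimum degree, so |R|·|B| ≤ m, while 2e_red ≤ |R|·n + m and
-- 2e_blue ≤ |B|·n + m. If both colours have at least n²/k edges this forces m ≥ n²/k²,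
-- hence M ≥ 2n² once n > 4k², and then #copies ≥ n⁴/(64k⁴). For β > 0 we take k to be
-- the denominator of β, so that β ≥ 1/k.

module Submission where

open import Defs renaming (sym to col-sym)

module Counting where

  open import Data.Bool using (Bool; true; false; _∧_; not)
  open import Data.Bool.Properties using (∧-idempotentCommutativeMonoid; ∧-zeroʳ; ∧-identityʳ)
  open import Data.Fin using (Fin; zero; suc; toℕ; _≟_)
  open import Data.Fin.Properties using (toℕ-injective)
  open import Data.List using (tabulate)
  open import Data.List.Properties using (map-tabulate)
  open import Data.Nat
    using (ℕ; zero; suc; _+_; _*_; _^_; _⊓_; _≤_; _<_; _<ᵇ_; _≤ᵇ_; z≤n; s≤s; NonZero)
  import Data.Nat.ListAction as List
  open import Data.Nat.Properties hiding (_≟_)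
  open import Data.Nat.Tactic.RingSolver using (solve-∀)
  open import Data.Vec.Functional using (Vector)
  open import Function using (_∘_; case_of_)
  open import Relation.Binary using (tri<; tri≈; tri>)
  open import Relation.Binary.PropositionalEquality
  open import Relation.Nullary.Decidable using (⌊_⌋; yes; no; dec-true; dec-false; isYes≗does)
  open import Algebra.Properties.CommutativeSemigroup +-commutativeSemigroup
    using () renaming (interchange to +-interchange)
  open import Algebra.Properties.CommutativeSemigroup *-commutativeSemigroup
    using () renaming (interchange to *-interchange)
  -- ∑[ i < n ] binds tighter than _*_ and _+_: ∑[ i < n ] f i * c means (∑[ i < n ] f i) * c.
  open import Algebra.Properties.Semiring.Sum +-*-semiring
    using (sum; sum-syntax; sum-cong-≗; *-distribˡ-sum; *-distribʳ-sum)
  open import Algebra.Solver.IdempotentCommutativeMonoid ∧-idempotentCommutativeMonoid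
    using (solve; _⊕_; _⊜_)

  ΣFin≡∑ : ∀ n (f : Fin n → ℕ) → ΣFin n f ≡ ∑[ i < n ] f i
  ΣFin≡∑ n f = trans (cong List.sum (map-tabulate (λ i → i) f)) (sum-tabulate n)
    where
    sum-tabulate : ∀ n {f : Fin n → ℕ} → List.sum (tabulate f) ≡ sum f
    sum-tabulate zero = refl
    sum-tabulate (suc n) {f} = cong (f zero +_) (sum-tabulate n)

  sum-const : ∀ n c → ∑[ i < n ] c ≡ n * c
  sum-const zero c = refl
  sum-const (suc n) c = cong (c +_) (sum-const n c)

  sum-+ : ∀ {n} (f g : Vector ℕ n) → ∑[ i < n ] (f i + g i) ≡ sum f + sum g
  sum-+ {zero} f g = refl
  sum-+ {suc n} f g =
    trans (cong (f zero + g zero +_) (sum-+ (f ∘ suc) (g ∘ suc))) (+-interchange (f zero) (g zero) _ _)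

  sum-comm : ∀ {m n} (f : Fin m → Fin n → ℕ) →
    ∑[ i < m ] ∑[ j < n ] f i j ≡ ∑[ j < n ] ∑[ i < m ] f i j
  sum-comm {zero} {n} f = sym (trans (sum-const n 0) (*-zeroʳ n))
  sum-comm {suc m} f = trans (cong (sum (f zero) +_) (sum-comm (f ∘ suc))) (sym (sum-+ (f zero) _))

  sum-mono-≤ : ∀ {n} {f g : Vector ℕ n} → (∀ i → f i ≤ g i) → sum f ≤ sum g
  sum-mono-≤ {zero} f≤g = z≤n
  sum-mono-≤ {suc n} f≤g = +-mono-≤ (f≤g zero) (sum-mono-≤ (f≤g ∘ suc))

  sum-*-sum : ∀ {m n} (u : Vector ℕ m) (v : Vector ℕ n) →
    ∑[ i < m ] ∑[ j < n ] (u i * v j) ≡ sum u * sum v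
  sum-*-sum u v =
    trans (sum-cong-≗ (λ i → sym (*-distribˡ-sum (u i) v))) (sym (*-distribʳ-sum (sum v) u))

  sum-*-+ : ∀ {n} k (f g : Vector ℕ n) → ∑[ i < n ] (k * f i + g i) ≡ k * sum f + sum g
  sum-*-+ {n} k f g = trans (sum-+ {n} _ g) (cong (_+ sum g) (sym (*-distribˡ-sum k f)))

  sum-𝟙-≟ : ∀ {n} (x : Fin n) → ∑[ y < n ] 𝟙 ⌊ x ≟ y ⌋ ≡ 1
  sum-𝟙-≟ {suc n} zero = cong suc (trans (sum-const n 0) (*-zeroʳ n))
  sum-𝟙-≟ {suc n} (suc x) = trans (sum-cong-≗ (λ y → cong 𝟙 (≟-suc y))) (sum-𝟙-≟ x)
    where
    ≟-suc : ∀ y → ⌊ suc x ≟ suc y ⌋ ≡ ⌊ x ≟ y ⌋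
    ≟-suc y with x ≟ y
    ... | yes _ = refl
    ... | no _ = refl

  𝟙-∧ : ∀ x y → 𝟙 (x ∧ y) ≡ 𝟙 x * 𝟙 y
  𝟙-∧ false y = refl
  𝟙-∧ true  y = sym (+-identityʳ (𝟙 y))

  𝟙-idem : ∀ x → 𝟙 x * 𝟙 x ≡ 𝟙 x
  𝟙-idem false = refl
  𝟙-idem true  = refl

  ≠ᵇ-irrefl : ∀ {n} (x : Fin n) → (x ≠ᵇ x) ≡ false
  ≠ᵇ-irrefl x = cong not (trans (isYes≗does (x ≟ x)) (dec-true (x ≟ x) refl))

  ≢⇒≠ᵇ : ∀ {n} {x y : Fin n} → x ≢ y → (x ≠ᵇ y) ≡ true
  ≢⇒≠ᵇ {x = x} {y} x≢y = cong not (trans (isYes≗does (x ≟ y)) (dec-false (x ≟ y) x≢y))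

  ≠ᵇ-sym : ∀ {n} (x y : Fin n) → (x ≠ᵇ y) ≡ (y ≠ᵇ x)
  ≠ᵇ-sym x y with x ≟ y
  ... | yes refl = sym (≠ᵇ-irrefl x)
  ... | no x≢y   = sym (≢⇒≠ᵇ (x≢y ∘ sym))

  𝟙-≠ᵇ-∧ : ∀ {n} (x y : Fin n) b →
    𝟙 ((x ≠ᵇ y) ∧ b) ≡ 𝟙 ((toℕ x <ᵇ toℕ y) ∧ b) + 𝟙 ((toℕ y <ᵇ toℕ x) ∧ b)
  𝟙-≠ᵇ-∧ x y b with <-cmp (toℕ x) (toℕ y)
  ... | tri< x<y _ x≯y
    rewrite ≢⇒≠ᵇ (λ x≡y → <-irrefl (cong toℕ x≡y) x<y)
          | dec-true (toℕ x <? toℕ y) x<y | dec-false (toℕ y <? toℕ x) x≯y = sym (+-identityʳ _)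
  ... | tri> x≮y _ y<x
    rewrite ≢⇒≠ᵇ (λ x≡y → <-irrefl (cong toℕ (sym x≡y)) y<x)
          | dec-false (toℕ x <? toℕ y) x≮y | dec-true (toℕ y <? toℕ x) y<x = refl
  ... | tri≈ _ x≡y _ with refl ← toℕ-injective x≡y
    rewrite ≠ᵇ-irrefl x | dec-false (toℕ x <? toℕ x) (<-irrefl refl) = refl

  pairSum : ∀ {n} → Vector ℕ n → ℕ
  pairSum {n} f = ∑[ a < n ] ∑[ c < n ] (𝟙 (toℕ a <ᵇ toℕ c) * (f a * f c))

  square-of-sum : ∀ {n} (f : Vector ℕ n) → 2 * pairSum f + ∑[ i < n ] (f i * f i) ≡ sum f * sum f
  square-of-sum {zero} f = refl
  square-of-sum {suc n} f = begin
    2 * pairSum f + (x * x + Q)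
      ≡⟨ cong (λ p → 2 * (p + pairSum (f ∘ suc)) + (x * x + Q)) pairSum-head ⟩
    2 * (x * S + pairSum (f ∘ suc)) + (x * x + Q) ≡⟨ regroup x S (pairSum (f ∘ suc)) Q ⟩
    x * x + 2 * x * S + (2 * pairSum (f ∘ suc) + Q) ≡⟨ cong (x * x + 2 * x * S +_) (square-of-sum (f ∘ suc)) ⟩
    x * x + 2 * x * S + S * S                   ≡⟨ binomial x S ⟩
    (x + S) * (x + S)                           ∎
    where
    open ≡-Reasoning
    x S Q : ℕ
    x = f zero
    S = sum (f ∘ suc)
    Q = ∑[ i < n ] (f (suc i) * f (suc i))
    pairSum-head : ∑[ c < n ] (1 * (x * f (suc c))) ≡ x * S
    pairSum-head = trans (sum-cong-≗ {n} (λ c → *-identityˡ _)) (sym (*-distribˡ-sum x (f ∘ suc)))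
    regroup : ∀ x S p q → 2 * (x * S + p) + (x * x + q) ≡ x * x + 2 * x * S + (2 * p + q)
    regroup = solve-∀
    binomial : ∀ x S → x * x + 2 * x * S + S * S ≡ (x + S) * (x + S)
    binomial = solve-∀

  square-of-count : ∀ {n} (f : Fin n → Bool) →
    2 * pairSum (𝟙 ∘ f) + ∑[ i < n ] 𝟙 (f i) ≡ ∑[ i < n ] 𝟙 (f i) * ∑[ i < n ] 𝟙 (f i)
  square-of-count {n} f =
    trans (cong (2 * pairSum (𝟙 ∘ f) +_) (sum-cong-≗ {n} (λ i → sym (𝟙-idem (f i))))) (square-of-sum (𝟙 ∘ f))

  2xy≤x²+y² : ∀ x y → 2 * x * y ≤ x * x + y * y
  2xy≤x²+y² zero y = z≤n
  2xy≤x²+y² (suc x) zero = ≤-trans (≤-reflexive (*-zeroʳ (2 * suc x))) z≤n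
  2xy≤x²+y² (suc x) (suc y) =
    subst₂ _≤_ (lhs x y) (rhs x y) (+-monoˡ-≤ (2 * x + 2 * y + 2) (2xy≤x²+y² x y))
    where
    lhs : ∀ x y → 2 * x * y + (2 * x + 2 * y + 2) ≡ 2 * suc x * suc y
    lhs = solve-∀
    rhs : ∀ x y → x * x + y * y + (2 * x + 2 * y + 2) ≡ suc x * suc x + suc y * suc y
    rhs = solve-∀

  cauchy-schwarz : ∀ {n} (f : Vector ℕ n) → sum f * sum f ≤ n * ∑[ i < n ] (f i * f i)
  cauchy-schwarz {zero} f = z≤n
  cauchy-schwarz {suc n} f = begin
    (x + S) * (x + S)                          ≡⟨ binomial x S ⟩
    x * x + 2 * x * S + S * S                  ≤⟨ +-mono-≤ (+-monoʳ-≤ (x * x) cross) (cauchy-schwarz (f ∘ suc)) ⟩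
    x * x + (n * (x * x) + Q) + n * Q          ≡⟨ regroup n (x * x) Q ⟩
    suc n * (x * x + Q)                        ∎
    where
    open ≤-Reasoning
    x S Q : ℕ
    x = f zero
    S = sum (f ∘ suc)
    Q = ∑[ i < n ] (f (suc i) * f (suc i))
    cross : 2 * x * S ≤ n * (x * x) + Q
    cross = begin
      2 * x * S                                 ≡⟨ *-distribˡ-sum (2 * x) (f ∘ suc) ⟩
      ∑[ i < n ] (2 * x * f (suc i))            ≤⟨ sum-mono-≤ (λ i → 2xy≤x²+y² x (f (suc i))) ⟩
      ∑[ i < n ] (x * x + f (suc i) * f (suc i)) ≡⟨ sum-+ {n} (λ _ → x * x) _ ⟩
      ∑[ i < n ] (x * x) + Q                    ≡⟨ cong (_+ Q) (sum-const n (x * x)) ⟩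
      n * (x * x) + Q                           ∎
    binomial : ∀ x S → (x + S) * (x + S) ≡ x * x + 2 * x * S + S * S
    binomial = solve-∀
    regroup : ∀ n a q → a + (n * a + q) + n * q ≡ suc n * (a + q)
    regroup = solve-∀

  cauchy-schwarz₂ : ∀ {m n} (f : Fin m → Fin n → ℕ) →
    let S = ∑[ i < m ] ∑[ j < n ] f i j in
    S * S ≤ m * n * ∑[ i < m ] ∑[ j < n ] (f i j * f i j)
  cauchy-schwarz₂ {m} {n} f = begin
    sum F * sum F                                     ≤⟨ cauchy-schwarz F ⟩
    m * ∑[ i < m ] (F i * F i)                         ≤⟨ *-monoʳ-≤ m (sum-mono-≤ (λ i → cauchy-schwarz (f i))) ⟩
    m * ∑[ i < m ] (n * ∑[ j < n ] (f i j * f i j))    ≡⟨ cong (m *_) (sym (*-distribˡ-sum {m} n _)) ⟩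
    m * (n * ∑[ i < m ] ∑[ j < n ] (f i j * f i j))    ≡⟨ sym (*-assoc m n _) ⟩
    m * n * ∑[ i < m ] ∑[ j < n ] (f i j * f i j)      ∎
    where
    open ≤-Reasoning
    F : Fin m → ℕ
    F i = ∑[ j < n ] f i j

  ⊓*+≤2* : ∀ r b → r ⊓ b * (r + b) ≤ 2 * (r * b)
  ⊓*+≤2* r b = begin
    r ⊓ b * (r + b)       ≡⟨ *-distribˡ-+ (r ⊓ b) r b ⟩
    r ⊓ b * r + r ⊓ b * b ≤⟨ +-mono-≤ (*-monoˡ-≤ r (m⊓n≤n r b)) (*-monoˡ-≤ b (m⊓n≤m r b)) ⟩
    b * r + r * b         ≡⟨ cong (_+ r * b) (*-comm b r) ⟩
    r * b + r * b         ≡⟨ cong (r * b +_) (sym (+-identityʳ (r * b))) ⟩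
    2 * (r * b)           ∎
    where open ≤-Reasoning

  ⊓-by-majority : ∀ r b → 𝟙 (not (b ≤ᵇ r)) * r + 𝟙 (b ≤ᵇ r) * b ≡ r ⊓ b
  ⊓-by-majority r b with b ≤? r
  ... | yes b≤r rewrite dec-true (b ≤? r) b≤r = trans (+-identityʳ b) (sym (m≥n⇒m⊓n≡n b≤r))
  ... | no b≰r rewrite dec-false (b ≤? r) b≰r =
    trans (trans (+-identityʳ _) (+-identityʳ r)) (sym (m≤n⇒m⊓n≡m (<⇒≤ (≰⇒> b≰r))))

  majority≤ : ∀ {r b n} → r ≤ n → r ≤ 𝟙 (b ≤ᵇ r) * n + r ⊓ b
  majority≤ {r} {b} {n} r≤n with b ≤? r
  ... | yes b≤r rewrite dec-true (b ≤? r) b≤r = ≤-trans r≤n (≤-trans (m≤m+n n 0) (m≤m+n _ (r ⊓ b)))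
  ... | no b≰r rewrite dec-false (b ≤? r) b≰r = ≤-reflexive (sym (m≤n⇒m⊓n≡m (<⇒≤ (≰⇒> b≰r))))

  minority≤ : ∀ {r b n} → b ≤ n → b ≤ 𝟙 (not (b ≤ᵇ r)) * n + r ⊓ b
  minority≤ {r} {b} {n} b≤n with b ≤? r
  ... | yes b≤r rewrite dec-true (b ≤? r) b≤r = ≤-reflexive (sym (m≥n⇒m⊓n≡n b≤r))
  ... | no b≰r rewrite dec-false (b ≤? r) b≰r = ≤-trans b≤n (≤-trans (m≤m+n n 0) (m≤m+n _ (r ⊓ b)))

  few-minima⇒large-majority : ∀ {k n e s m} →
    n * n ≤ k * e → e + e ≤ s * n + m → k * m < n * n → n < k * s
  few-minima⇒large-majority {k} {n} {e} {s} {m} n²≤ke 2e≤ km<n² =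
    *-cancelʳ-< n n (k * s) (+-cancelʳ-< (n * n) (n * n) (k * s * n) (begin-strict
      n * n + n * n     ≤⟨ +-mono-≤ n²≤ke n²≤ke ⟩
      k * e + k * e     ≡⟨ sym (*-distribˡ-+ k e e) ⟩
      k * (e + e)       ≤⟨ *-monoʳ-≤ k 2e≤ ⟩
      k * (s * n + m)   ≡⟨ distrib k s n m ⟩
      k * s * n + k * m <⟨ +-monoʳ-< (k * s * n) km<n² ⟩
      k * s * n + n * n ∎))
    where
    open ≤-Reasoning
    distrib : ∀ k s n m → k * (s * n + m) ≡ k * s * n + k * m
    distrib = solve-∀

  minima-lower-bound : ∀ k n {eR eB sR sB m} .{{_ : NonZero k}} →
    n * n ≤ k * eR → n * n ≤ k * eB →
    eR + eR ≤ sR * n + m → eB + eB ≤ sB * n + m → sR * sB ≤ m →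
    n * n ≤ k * k * m
  minima-lower-bound k n {sR = sR} {sB} {m} n²≤keR n²≤keB 2eR≤ 2eB≤ sRsB≤m with n * n ≤? k * m
  ... | yes n²≤km = ≤-trans n²≤km (≤-trans (m≤n*m (k * m) k) (≤-reflexive (sym (*-assoc k k m))))
  -- otherwise both majority classes have more than n / k vertices
  ... | no n²≰km = begin
    n * n             ≤⟨ *-mono-≤ (<⇒≤ (large 2eR≤ n²≤keR)) (<⇒≤ (large 2eB≤ n²≤keB)) ⟩
    k * sR * (k * sB) ≡⟨ *-interchange k sR k sB ⟩
    k * k * (sR * sB) ≤⟨ *-monoʳ-≤ (k * k) sRsB≤m ⟩
    k * k * m         ∎
    where
    open ≤-Reasoning
    large : ∀ {e s} → e + e ≤ s * n + m → n * n ≤ k * e → n < k * s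
    large {e} {s} 2e≤ n²≤ke = few-minima⇒large-majority {k} {n} {e} {s} {m} n²≤ke 2e≤ (≰⇒> n²≰km)

  square≤4*N*c : ∀ {N c M} → M * M ≤ N * (2 * c + M) → 2 * N ≤ M → M * M ≤ 4 * N * c
  square≤4*N*c {N} {c} {M} M²≤ 2N≤M = +-cancelʳ-≤ (M * M) (M * M) (4 * N * c) (begin
    M * M + M * M                       ≤⟨ +-mono-≤ M²≤ M²≤ ⟩
    N * (2 * c + M) + N * (2 * c + M)   ≡⟨ expand N c M ⟩
    4 * N * c + 2 * N * M               ≤⟨ +-monoʳ-≤ (4 * N * c) (*-monoˡ-≤ M 2N≤M) ⟩
    4 * N * c + M * M                   ∎)
    where
    open ≤-Reasoning
    expand : ∀ N c M → N * (2 * c + M) + N * (2 * c + M) ≡ 4 * N * c + 2 * N * M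
    expand = solve-∀

  quartic-bound : ∀ k p {m M c} .{{_ : NonZero k}} → let n = suc p in
    n * n ≤ k * k * m → m * n ≤ 2 * M + m → M * M ≤ n * n * (2 * c + M) → 4 * (k * k) ≤ p →
    n * n * n * n ≤ 64 * (k * k * k * k) * c
  quartic-bound k p {m} {M} {c} n²≤k²m mn≤2M+m M²≤ 4k²≤p = *-cancelʳ-≤ _ _ (n * n) (begin
    n * n * n * n * (n * n)                     ≤⟨ *-monoʳ-≤ (n * n * n * n) (*-mono-≤ n≤2p n≤2p) ⟩
    n * n * n * n * (2 * p * (2 * p))           ≡⟨ regroup₁ n p ⟩
    4 * (n * n * p * (n * n * p))               ≤⟨ *-monoʳ-≤ 4 (*-mono-≤ n²p≤2k²M n²p≤2k²M) ⟩
    4 * (2 * (k * k) * M * (2 * (k * k) * M))   ≡⟨ regroup₂ k M ⟩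
    16 * (k * k * k * k) * (M * M)              ≤⟨ *-monoʳ-≤ (16 * (k * k * k * k)) (square≤4*N*c M²≤ 2n²≤M) ⟩
    16 * (k * k * k * k) * (4 * (n * n) * c)    ≡⟨ regroup₃ k n c ⟩
    64 * (k * k * k * k) * c * (n * n)          ∎)
    where
    open ≤-Reasoning
    n : ℕ
    n = suc p
    instance
      k²≢0 : NonZero (k * k)
      k²≢0 = m*n≢0 k k
      2k²≢0 : NonZero (2 * (k * k))
      2k²≢0 = m*n≢0 2 (k * k)
    regroup₀ : ∀ k n → 2 * (k * k) * (2 * (n * n)) ≡ n * n * (4 * (k * k))
    regroup₀ = solve-∀
    *-assoc-comm : ∀ a b c → a * (b * c) ≡ b * a * c
    *-assoc-comm = solve-∀
    regroup₁ : ∀ n p → n * n * n * n * (2 * p * (2 * p)) ≡ 4 * (n * n * p * (n * n * p))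
    regroup₁ = solve-∀
    regroup₂ : ∀ k M → 4 * (2 * (k * k) * M * (2 * (k * k) * M)) ≡ 16 * (k * k * k * k) * (M * M)
    regroup₂ = solve-∀
    regroup₃ : ∀ k n c → 16 * (k * k * k * k) * (4 * (n * n) * c) ≡ 64 * (k * k * k * k) * c * (n * n)
    regroup₃ = solve-∀
    mp≤2M : m * p ≤ 2 * M
    mp≤2M = +-cancelʳ-≤ m (m * p) (2 * M)
      (subst (_≤ 2 * M + m) (trans (*-suc m p) (+-comm m (m * p))) mn≤2M+m)
    n²p≤2k²M : n * n * p ≤ 2 * (k * k) * M
    n²p≤2k²M = begin
      n * n * p         ≤⟨ *-monoˡ-≤ p n²≤k²m ⟩
      k * k * m * p     ≡⟨ *-assoc (k * k) m p ⟩
      k * k * (m * p)   ≤⟨ *-monoʳ-≤ (k * k) mp≤2M ⟩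
      k * k * (2 * M)   ≡⟨ *-assoc-comm (k * k) 2 M ⟩
      2 * (k * k) * M   ∎
    2n²≤M : 2 * (n * n) ≤ M
    2n²≤M = *-cancelˡ-≤ (2 * (k * k)) (begin
      2 * (k * k) * (2 * (n * n))  ≡⟨ regroup₀ k n ⟩
      n * n * (4 * (k * k))        ≤⟨ *-monoʳ-≤ (n * n) 4k²≤p ⟩
      n * n * p                    ≤⟨ n²p≤2k²M ⟩
      2 * (k * k) * M              ∎)
    n≤2p : n ≤ 2 * p
    n≤2p = begin
      1 + p       ≤⟨ +-monoˡ-≤ p (≤-trans (s≤s z≤n) (≤-trans (m≤m*n 4 (k * k)) 4k²≤p)) ⟩
      p + p       ≡⟨ cong (p +_) (sym (+-identityʳ p)) ⟩
      2 * p       ∎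

  module _ {n} (ψ : EdgeColouring n) where

    joined : Colour → Fin n → Fin n → Bool
    joined c x y = (x ≠ᵇ y) ∧ (col ψ x y == c)

    deg : Colour → Fin n → ℕ
    deg c x = ∑[ y < n ] 𝟙 (joined c x y)

    handshake : ∀ c → ∑[ x < n ] deg c x ≡ edgesOfColour ψ c + edgesOfColour ψ c
    handshake c = begin
      ∑[ x < n ] ∑[ y < n ] 𝟙 (joined c x y)
        ≡⟨ sum-cong-≗ {n} (λ x → trans (sum-cong-≗ {n} (λ y → split x y)) (sum-+ {n} _ _)) ⟩
      ∑[ x < n ] (∑[ y < n ] E x y + ∑[ y < n ] E y x)
        ≡⟨ sum-+ {n} _ _ ⟩
      ∑[ x < n ] ∑[ y < n ] E x y + ∑[ x < n ] ∑[ y < n ] E y x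
        ≡⟨ cong₂ _+_ edges (trans (sum-comm {n} {n} (λ x y → E y x)) edges) ⟩
      edgesOfColour ψ c + edgesOfColour ψ c ∎
      where
      open ≡-Reasoning
      E : Fin n → Fin n → ℕ
      E x y = 𝟙 ((toℕ x <ᵇ toℕ y) ∧ (col ψ x y == c))
      split : ∀ x y → 𝟙 (joined c x y) ≡ E x y + E y x
      split x y = trans (𝟙-≠ᵇ-∧ x y _)
        (cong (λ c′ → E x y + 𝟙 ((toℕ y <ᵇ toℕ x) ∧ (c′ == c))) (col-sym ψ x y))
      edges : ∑[ x < n ] ∑[ y < n ] E x y ≡ edgesOfColour ψ c
      edges = sym (trans (ΣFin≡∑ n _) (sum-cong-≗ {n} (λ x → ΣFin≡∑ n _)))

    deg-red+deg-blue : ∀ x → deg red x + deg blue x + 1 ≡ n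
    deg-red+deg-blue x = begin
      deg red x + deg blue x + 1
        ≡⟨ cong₂ _+_ (sym (sum-+ {n} _ _)) (sym (sum-𝟙-≟ x)) ⟩
      ∑[ y < n ] (𝟙 (joined red x y) + 𝟙 (joined blue x y)) + ∑[ y < n ] 𝟙 ⌊ x ≟ y ⌋
        ≡⟨ sym (sum-+ {n} _ _) ⟩
      ∑[ y < n ] (𝟙 (joined red x y) + 𝟙 (joined blue x y) + 𝟙 ⌊ x ≟ y ⌋)
        ≡⟨ sum-cong-≗ {n} (λ y → trichotomy ⌊ x ≟ y ⌋ (col ψ x y)) ⟩
      ∑[ y < n ] 1
        ≡⟨ trans (sum-const n 1) (*-identityʳ n) ⟩
      n ∎
      where
      open ≡-Reasoning
      trichotomy : ∀ e c → 𝟙 (not e ∧ (c == red)) + 𝟙 (not e ∧ (c == blue)) + 𝟙 e ≡ 1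
      trichotomy true  _    = refl
      trichotomy false red  = refl
      trichotomy false blue = refl

    redBlue : Fin n → Fin n → Fin n → Bool
    redBlue b d x = joined red x b ∧ joined blue x d

    codeg : Fin n → Fin n → ℕ
    codeg b d = ∑[ x < n ] 𝟙 (redBlue b d x)

    redBlue-apart : ∀ b d x → redBlue b d x ∧ (b ≠ᵇ d) ≡ redBlue b d x
    redBlue-apart b d x with b ≟ d
    ... | yes refl = trans (∧-zeroʳ _) (sym (not-red-and-blue (col ψ x b)))
      where
      not-red-and-blue : ∀ c → ((x ≠ᵇ b) ∧ (c == red)) ∧ ((x ≠ᵇ b) ∧ (c == blue)) ≡ false
      not-red-and-blue red  = trans (cong (((x ≠ᵇ b) ∧ true) ∧_) (∧-zeroʳ (x ≠ᵇ b))) (∧-zeroʳ _)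
      not-red-and-blue blue = cong (_∧ ((x ≠ᵇ b) ∧ true)) (∧-zeroʳ (x ≠ᵇ b))
    ... | no _ = ∧-identityʳ _

    copy-as-pair : ∀ a b c d →
      𝟙 ( (toℕ a <ᵇ toℕ c)
        ∧ (a ≠ᵇ b) ∧ (a ≠ᵇ d) ∧ (b ≠ᵇ c) ∧ (b ≠ᵇ d) ∧ (c ≠ᵇ d)
        ∧ (col ψ a b == red) ∧ (col ψ b c == red)
        ∧ (col ψ c d == blue) ∧ (col ψ d a == blue))
      ≡ 𝟙 (toℕ a <ᵇ toℕ c) * (𝟙 (redBlue b d a) * 𝟙 (redBlue b d c))
    copy-as-pair a b c d rewrite ≠ᵇ-sym b c | col-sym ψ b c | col-sym ψ d a = begin
      𝟙 (a<c ∧ (a ≠ᵇ b) ∧ (a ≠ᵇ d) ∧ (c ≠ᵇ b) ∧ (b ≠ᵇ d) ∧ (c ≠ᵇ d) ∧ r-ab ∧ r-cb ∧ b-cd ∧ b-ad)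
        ≡⟨ cong 𝟙 (regroup a<c (a ≠ᵇ b) (a ≠ᵇ d) (c ≠ᵇ b) (b ≠ᵇ d) (c ≠ᵇ d) r-ab r-cb b-cd b-ad) ⟩
      𝟙 (a<c ∧ (redBlue b d a ∧ (b ≠ᵇ d)) ∧ redBlue b d c)
        ≡⟨ cong (λ z → 𝟙 (a<c ∧ z ∧ redBlue b d c)) (redBlue-apart b d a) ⟩
      𝟙 (a<c ∧ redBlue b d a ∧ redBlue b d c)
        ≡⟨ trans (𝟙-∧ a<c _) (cong (𝟙 a<c *_) (𝟙-∧ (redBlue b d a) (redBlue b d c))) ⟩
      𝟙 a<c * (𝟙 (redBlue b d a) * 𝟙 (redBlue b d c)) ∎
      where
      open ≡-Reasoning
      a<c r-ab r-cb b-cd b-ad : Bool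
      a<c = toℕ a <ᵇ toℕ c
      r-ab = col ψ a b == red
      r-cb = col ψ c b == red
      b-cd = col ψ c d == blue
      b-ad = col ψ a d == blue
      regroup : ∀ p ab ad cb bd cd r r′ s s′ →
        p ∧ ab ∧ ad ∧ cb ∧ bd ∧ cd ∧ r ∧ r′ ∧ s ∧ s′
          ≡ p ∧ (((ab ∧ r) ∧ (ad ∧ s′)) ∧ bd) ∧ ((cb ∧ r′) ∧ (cd ∧ s))
      regroup = solve 10 (λ p ab ad cb bd cd r r′ s s′ →
        p ⊕ ab ⊕ ad ⊕ cb ⊕ bd ⊕ cd ⊕ r ⊕ r′ ⊕ s ⊕ s′
          ⊜ p ⊕ (((ab ⊕ r) ⊕ (ad ⊕ s′)) ⊕ bd) ⊕ ((cb ⊕ r′) ⊕ (cd ⊕ s))) refl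

    copies-as-pairs : copiesCrrbb ψ ≡ ∑[ b < n ] ∑[ d < n ] pairSum (𝟙 ∘ redBlue b d)
    copies-as-pairs = begin
      copiesCrrbb ψ
        ≡⟨ trans (ΣFin≡∑ n _) (sum-cong-≗ {n} λ a → trans (ΣFin≡∑ n _) (sum-cong-≗ {n} λ b →
             trans (ΣFin≡∑ n _) (sum-cong-≗ {n} λ c → trans (ΣFin≡∑ n _) (sum-cong-≗ {n} λ d →
             copy-as-pair a b c d)))) ⟩
      ∑[ a < n ] ∑[ b < n ] ∑[ c < n ] ∑[ d < n ] P a b c d
        ≡⟨ sum-comm {n} {n} (λ a b → ∑[ c < n ] ∑[ d < n ] P a b c d) ⟩
      ∑[ b < n ] ∑[ a < n ] ∑[ c < n ] ∑[ d < n ] P a b c d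
        ≡⟨ sum-cong-≗ {n} (λ b → trans (sum-cong-≗ {n} (λ a → sum-comm {n} {n} (P a b)))
                                       (sum-comm {n} {n} (λ a d → ∑[ c < n ] P a b c d))) ⟩
      ∑[ b < n ] ∑[ d < n ] ∑[ a < n ] ∑[ c < n ] P a b c d ∎
      where
      open ≡-Reasoning
      P : Fin n → Fin n → Fin n → Fin n → ℕ
      P a b c d = 𝟙 (toℕ a <ᵇ toℕ c) * (𝟙 (redBlue b d a) * 𝟙 (redBlue b d c))

    sum-codeg : ∑[ b < n ] ∑[ d < n ] codeg b d ≡ ∑[ x < n ] (deg red x * deg blue x)
    sum-codeg = begin
      ∑[ b < n ] ∑[ d < n ] ∑[ x < n ] 𝟙 (redBlue b d x)
        ≡⟨ sum-cong-≗ {n} (λ b → sum-comm {n} {n} (λ d x → 𝟙 (redBlue b d x))) ⟩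
      ∑[ b < n ] ∑[ x < n ] ∑[ d < n ] 𝟙 (redBlue b d x)
        ≡⟨ sum-comm {n} {n} (λ b x → ∑[ d < n ] 𝟙 (redBlue b d x)) ⟩
      ∑[ x < n ] ∑[ b < n ] ∑[ d < n ] 𝟙 (redBlue b d x)
        ≡⟨ sum-cong-≗ {n} (λ x → trans
             (sum-cong-≗ {n} (λ b → sum-cong-≗ {n} (λ d → 𝟙-∧ (joined red x b) (joined blue x d))))
             (sum-*-sum (𝟙 ∘ joined red x) (𝟙 ∘ joined blue x))) ⟩
      ∑[ x < n ] (deg red x * deg blue x) ∎
      where open ≡-Reasoning

    copies-codeg : 2 * copiesCrrbb ψ + ∑[ b < n ] ∑[ d < n ] codeg b d
                 ≡ ∑[ b < n ] ∑[ d < n ] (codeg b d * codeg b d)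
    copies-codeg = begin
      2 * copiesCrrbb ψ + ∑[ b < n ] ∑[ d < n ] codeg b d
        ≡⟨ cong (λ c → 2 * c + ∑[ b < n ] ∑[ d < n ] codeg b d) copies-as-pairs ⟩
      2 * ∑[ b < n ] ∑[ d < n ] pairSum (𝟙 ∘ redBlue b d) + ∑[ b < n ] ∑[ d < n ] codeg b d
        ≡⟨ sym (sum-*-+ {n} 2 _ _) ⟩
      ∑[ b < n ] (2 * ∑[ d < n ] pairSum (𝟙 ∘ redBlue b d) + ∑[ d < n ] codeg b d)
        ≡⟨ sum-cong-≗ {n} (λ b → trans (sym (sum-*-+ {n} 2 _ _))
                                       (sum-cong-≗ {n} (λ d → square-of-count (redBlue b d)))) ⟩
      ∑[ b < n ] ∑[ d < n ] (codeg b d * codeg b d) ∎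
      where open ≡-Reasoning

    deg-red≤n : ∀ x → deg red x ≤ n
    deg-red≤n x = subst (deg red x ≤_) (deg-red+deg-blue x) (≤-trans (m≤m+n _ (deg blue x)) (m≤m+n _ 1))

    deg-blue≤n : ∀ x → deg blue x ≤ n
    deg-blue≤n x = subst (deg blue x ≤_) (deg-red+deg-blue x) (≤-trans (m≤n+m _ (deg red x)) (m≤m+n _ 1))

    redMajor : Fin n → Bool
    redMajor x = deg blue x ≤ᵇ deg red x

    minDeg : Fin n → ℕ
    minDeg x = deg red x ⊓ deg blue x

    red-edges≤ : edgesOfColour ψ red + edgesOfColour ψ red ≤ ∑[ x < n ] 𝟙 (redMajor x) * n + sum minDeg
    red-edges≤ = begin
      edgesOfColour ψ red + edgesOfColour ψ red   ≡⟨ sym (handshake red) ⟩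
      ∑[ x < n ] deg red x                        ≤⟨ sum-mono-≤ (λ x → majority≤ (deg-red≤n x)) ⟩
      ∑[ x < n ] (𝟙 (redMajor x) * n + minDeg x)   ≡⟨ sum-+ {n} _ minDeg ⟩
      ∑[ x < n ] (𝟙 (redMajor x) * n) + sum minDeg
        ≡⟨ cong (_+ sum minDeg) (sym (*-distribʳ-sum n (𝟙 ∘ redMajor))) ⟩
      ∑[ x < n ] 𝟙 (redMajor x) * n + sum minDeg  ∎
      where open ≤-Reasoning

    blue-edges≤ :
      edgesOfColour ψ blue + edgesOfColour ψ blue ≤ ∑[ x < n ] 𝟙 (not (redMajor x)) * n + sum minDeg
    blue-edges≤ = begin
      edgesOfColour ψ blue + edgesOfColour ψ blue       ≡⟨ sym (handshake blue) ⟩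
      ∑[ x < n ] deg blue x                             ≤⟨ sum-mono-≤ (λ x → minority≤ (deg-blue≤n x)) ⟩
      ∑[ x < n ] (𝟙 (not (redMajor x)) * n + minDeg x)   ≡⟨ sum-+ {n} _ minDeg ⟩
      ∑[ x < n ] (𝟙 (not (redMajor x)) * n) + sum minDeg
        ≡⟨ cong (_+ sum minDeg) (sym (*-distribʳ-sum n (𝟙 ∘ not ∘ redMajor))) ⟩
      ∑[ x < n ] 𝟙 (not (redMajor x)) * n + sum minDeg  ∎
      where open ≤-Reasoning

    majorities≤ : ∑[ x < n ] 𝟙 (redMajor x) * ∑[ x < n ] 𝟙 (not (redMajor x)) ≤ sum minDeg
    majorities≤ = begin
      ∑[ x < n ] 𝟙 (redMajor x) * ∑[ y < n ] 𝟙 (not (redMajor y))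
        ≡⟨ sym (sum-*-sum (𝟙 ∘ redMajor) (𝟙 ∘ not ∘ redMajor)) ⟩
      ∑[ x < n ] ∑[ y < n ] (𝟙 (redMajor x) * 𝟙 (not (redMajor y)))
        ≤⟨ sum-mono-≤ (λ x → sum-mono-≤ (λ y → cross-edge x y)) ⟩
      ∑[ x < n ] ∑[ y < n ] (Red y x + Blue x y)
        ≡⟨ trans (sum-cong-≗ {n} (λ x → sum-+ {n} _ _)) (sum-+ {n} _ _) ⟩
      ∑[ x < n ] ∑[ y < n ] Red y x + ∑[ x < n ] ∑[ y < n ] Blue x y
        ≡⟨ cong₂ _+_
             (trans (sum-comm {n} {n} (λ x y → Red y x))
                    (sum-cong-≗ {n} λ y → sym (*-distribˡ-sum (𝟙 (not (redMajor y))) (𝟙 ∘ joined red y))))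
             (sum-cong-≗ {n} λ x → sym (*-distribˡ-sum (𝟙 (redMajor x)) (𝟙 ∘ joined blue x))) ⟩
      ∑[ y < n ] (𝟙 (not (redMajor y)) * deg red y) + ∑[ x < n ] (𝟙 (redMajor x) * deg blue x)
        ≡⟨ sym (sum-+ {n} _ _) ⟩
      ∑[ x < n ] (𝟙 (not (redMajor x)) * deg red x + 𝟙 (redMajor x) * deg blue x)
        ≡⟨ sum-cong-≗ {n} (λ x → ⊓-by-majority (deg red x) (deg blue x)) ⟩
      sum minDeg ∎
      where
      open ≤-Reasoning
      Red Blue : Fin n → Fin n → ℕ
      Red y x = 𝟙 (not (redMajor y)) * 𝟙 (joined red y x)
      Blue x y = 𝟙 (redMajor x) * 𝟙 (joined blue x y)
      cross-edge : ∀ x y → 𝟙 (redMajor x) * 𝟙 (not (redMajor y)) ≤ Red y x + Blue x y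
      cross-edge x y with redMajor x in rx | redMajor y in ry
      ... | false | _    = z≤n
      ... | true  | true = z≤n
      ... | true  | false
        rewrite ≢⇒≠ᵇ {x = x} {y} (λ { refl → case trans (sym rx) ry of λ () })
              | ≢⇒≠ᵇ {x = y} {x} (λ { refl → case trans (sym rx) ry of λ () })
              | col-sym ψ y x
        with col ψ x y
      ... | red  = s≤s z≤n
      ... | blue = s≤s z≤n

    minDeg*n≤ : sum minDeg * n ≤ 2 * ∑[ x < n ] (deg red x * deg blue x) + sum minDeg
    minDeg*n≤ = begin
      sum minDeg * n                                          ≡⟨ *-distribʳ-sum n minDeg ⟩
      ∑[ x < n ] (minDeg x * n)                               ≡⟨ sum-cong-≗ {n} split ⟩
      ∑[ x < n ] (minDeg x * (deg red x + deg blue x) + minDeg x)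
        ≤⟨ sum-mono-≤ (λ x → +-monoˡ-≤ (minDeg x) (⊓*+≤2* (deg red x) (deg blue x))) ⟩
      ∑[ x < n ] (2 * (deg red x * deg blue x) + minDeg x)    ≡⟨ sum-*-+ {n} 2 _ minDeg ⟩
      2 * ∑[ x < n ] (deg red x * deg blue x) + sum minDeg    ∎
      where
      open ≤-Reasoning
      distrib : ∀ a s → a * (s + 1) ≡ a * s + a
      distrib = solve-∀
      split : ∀ x → minDeg x * n ≡ minDeg x * (deg red x + deg blue x) + minDeg x
      split x = trans (cong (minDeg x *_) (sym (deg-red+deg-blue x))) (distrib (minDeg x) _)

    minDeg-lower-bound : ∀ k .{{_ : NonZero k}} →
      n * n ≤ k * edgesOfColour ψ red → n * n ≤ k * edgesOfColour ψ blue → n * n ≤ k * k * sum minDeg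
    minDeg-lower-bound k red-dense blue-dense =
      minima-lower-bound k n {sR = ∑[ x < n ] 𝟙 (redMajor x)} {∑[ x < n ] 𝟙 (not (redMajor x))} {sum minDeg}
        red-dense blue-dense red-edges≤ blue-edges≤ majorities≤

  copies-lower-bound : ∀ k {p} .{{_ : NonZero k}} (ψ : EdgeColouring (suc p)) → 4 * (k * k) ≤ p →
    suc p ^ 2 ≤ k * edgesOfColour ψ red → suc p ^ 2 ≤ k * edgesOfColour ψ blue →
    suc p ^ 4 ≤ 64 * k ^ 4 * copiesCrrbb ψ
  copies-lower-bound k {p} ψ 4k²≤p n²≤keR n²≤keB = subst₂ _≤_ (n⁴ n) (cong (_* copiesCrrbb ψ) (64k⁴ k))
    (quartic-bound k p
      (minDeg-lower-bound ψ k (subst (_≤ k * edgesOfColour ψ red) (n² n) n²≤keR)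
                              (subst (_≤ k * edgesOfColour ψ blue) (n² n) n²≤keB))
      (minDeg*n≤ ψ) codeg-square 4k²≤p)
    where
    n M T : ℕ
    n = suc p
    M = ∑[ x < n ] (deg ψ red x * deg ψ blue x)
    T = ∑[ b < n ] ∑[ d < n ] codeg ψ b d
    codeg-square : M * M ≤ n * n * (2 * copiesCrrbb ψ + M)
    codeg-square = begin
      M * M
        ≡⟨ cong₂ _*_ (sum-codeg ψ) (sum-codeg ψ) ⟨
      T * T
        ≤⟨ cauchy-schwarz₂ (codeg ψ) ⟩
      n * n * ∑[ b < n ] ∑[ d < n ] (codeg ψ b d * codeg ψ b d)
        ≡⟨ cong (n * n *_) (copies-codeg ψ) ⟨
      n * n * (2 * copiesCrrbb ψ + T)
        ≡⟨ cong (λ S → n * n * (2 * copiesCrrbb ψ + S)) (sum-codeg ψ) ⟩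
      n * n * (2 * copiesCrrbb ψ + M) ∎
      where open ≤-Reasoning
    n² : ∀ n → n * (n * 1) ≡ n * n
    n² = solve-∀
    n⁴ : ∀ n → n * n * n * n ≡ n * (n * (n * (n * 1)))
    n⁴ = solve-∀
    64k⁴ : ∀ k → 64 * (k * k * k * k) ≡ 64 * (k * (k * (k * (k * 1))))
    64k⁴ = solve-∀

open import Data.Integer as ℤ using (+_; +[1+_])
import Data.Integer.Properties as ℤ
open import Data.Nat using (ℕ; _≥_; _^_; suc; s≤s)
import Data.Nat as ℕ
import Data.Nat.Properties as ℕ
open import Data.Nat.Coprimality using (Coprime; 1-coprimeTo) renaming (sym to coprime-sym)
open import Data.Product using (Σ; _×_; _,_)
open import Data.Rational using (ℚ; 0ℚ; _<_; _≤_; _*_; mkℚ; Positive; positive; ↧ₙ_)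
import Data.Rational.Properties as ℚ
import Data.Rational.Unnormalised as ℚᵘ
import Data.Rational.Unnormalised.Properties as ℚᵘ
open import Data.Sign using (Sign)
open import Function using (_⇔_; mk⇔; Equivalence)
open import Relation.Binary.PropositionalEquality

open Counting using (copies-lower-bound)

ℕ→ℚ≡mkℚ : ∀ m → ℕ→ℚ m ≡ mkℚ (+ m) 0 (coprime-sym (1-coprimeTo m))
ℕ→ℚ≡mkℚ m = ℚ.normalize-coprime (coprime-sym (1-coprimeTo m))

-- Through ℚᵘ, both sides are the integer inequality (a · X) · 1 ≤ Y · (1 + d).
mkℚ*ℕ→ℚ≤ℕ→ℚ⇔ : ∀ a d .(c : Coprime a (suc d)) X Y →
  mkℚ (+ a) d c * ℕ→ℚ X ≤ ℕ→ℚ Y ⇔ a ℕ.* X ℕ.≤ suc d ℕ.* Y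
mkℚ*ℕ→ℚ≤ℕ→ℚ⇔ a d c X Y rewrite ℕ→ℚ≡mkℚ X | ℕ→ℚ≡mkℚ Y = mk⇔
  (λ h → from-ℤ (ℚᵘ.drop-*≤* (ℚᵘ.≤-respˡ-≃ (ℚ.toℚᵘ-homo-* p x) (ℚ.toℚᵘ-mono-≤ h))))
  (λ h → ℚ.toℚᵘ-cancel-≤ (ℚᵘ.≤-respˡ-≃ (ℚᵘ.≃-sym (ℚ.toℚᵘ-homo-* p x)) (ℚᵘ.*≤* (to-ℤ h))))
  where
  p x : ℚ
  p = mkℚ (+ a) d c
  x = mkℚ (+ X) 0 (coprime-sym (1-coprimeTo X))
  lhs : (Sign.+ ℤ.◃ (a ℕ.* X)) ℤ.* + 1 ≡ + (a ℕ.* X)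
  lhs = trans (cong (ℤ._* + 1) (ℤ.+◃n≡+n (a ℕ.* X))) (ℤ.*-identityʳ (+ (a ℕ.* X)))
  rhs : + Y ℤ.* + suc (d ℕ.* 1) ≡ + (suc d ℕ.* Y)
  rhs = trans (sym (ℤ.pos-* Y _))
    (cong +_ (trans (cong (λ e → Y ℕ.* suc e) (ℕ.*-identityʳ d)) (ℕ.*-comm Y (suc d))))
  from-ℤ : (Sign.+ ℤ.◃ (a ℕ.* X)) ℤ.* + 1 ℤ.≤ + Y ℤ.* + suc (d ℕ.* 1) → a ℕ.* X ℕ.≤ suc d ℕ.* Y
  from-ℤ z = ℤ.drop‿+≤+ (subst₂ ℤ._≤_ lhs rhs z)
  to-ℤ : a ℕ.* X ℕ.≤ suc d ℕ.* Y → (Sign.+ ℤ.◃ (a ℕ.* X)) ℤ.* + 1 ℤ.≤ + Y ℤ.* + suc (d ℕ.* 1)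
  to-ℤ h = subst₂ ℤ._≤_ (sym lhs) (sym rhs) (ℤ.+≤+ h)

*ℕ→ℚ≤ℕ→ℚ⇒≤ : ∀ β .{{_ : Positive β}} X Y → β * ℕ→ℚ X ≤ ℕ→ℚ Y → X ℕ.≤ ↧ₙ β ℕ.* Y
*ℕ→ℚ≤ℕ→ℚ⇒≤ (mkℚ +[1+ a ] d c) X Y βX≤Y =
  ℕ.≤-trans (ℕ.m≤m+n X (a ℕ.* X)) (Equivalence.to (mkℚ*ℕ→ℚ≤ℕ→ℚ⇔ (suc a) d c X Y) βX≤Y)

1/suc : ℕ → ℚ
1/suc K = mkℚ (+ 1) K (1-coprimeTo (suc K))

1/suc-*-bound : ∀ K X Y → X ℕ.≤ suc K ℕ.* Y → 1/suc K * ℕ→ℚ X ≤ ℕ→ℚ Y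
1/suc-*-bound K X Y X≤ = Equivalence.from (mkℚ*ℕ→ℚ≤ℕ→ℚ⇔ 1 K _ X Y)
  (subst (ℕ._≤ suc K ℕ.* Y) (sym (ℕ.*-identityˡ X)) X≤)

lemma4p4 : (β : ℚ) → 0ℚ < β →
    Σ ℚ λ λ′ → (0ℚ < λ′) × (Σ ℕ λ n₀ → (n : ℕ) → n ≥ n₀ →
      (ψ : EdgeColouring n) →
      β * ℕ→ℚ (n ^ 2) ≤ ℕ→ℚ (edgesOfColour ψ red) →
      β * ℕ→ℚ (n ^ 2) ≤ ℕ→ℚ (edgesOfColour ψ blue) →
      λ′ * ℕ→ℚ (n ^ 4) ≤ ℕ→ℚ (copiesCrrbb ψ))
lemma4p4 β 0<β = 1/suc K , ℚ.positive⁻¹ (1/suc K) , suc (4 ℕ.* (k ℕ.* k)) , bound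
  where
  instance
    β-positive : Positive β
    β-positive = positive 0<β
  k K : ℕ
  k = ↧ₙ β
  -- suc K reduces to 64 · k ^ 4, as k = ↧ₙ β is a successor.
  K = ℕ.pred (64 ℕ.* k ^ 4)
  bound : (n : ℕ) → n ≥ suc (4 ℕ.* (k ℕ.* k)) → (ψ : EdgeColouring n) →
    β * ℕ→ℚ (n ^ 2) ≤ ℕ→ℚ (edgesOfColour ψ red) →
    β * ℕ→ℚ (n ^ 2) ≤ ℕ→ℚ (edgesOfColour ψ blue) →
    1/suc K * ℕ→ℚ (n ^ 4) ≤ ℕ→ℚ (copiesCrrbb ψ)
  bound (suc p) (s≤s 4k²≤p) ψ red-dense blue-dense = 1/suc-*-bound K _ _
    (copies-lower-bound k ψ 4k²≤p (*ℕ→ℚ≤ℕ→ℚ⇒≤ β _ _ red-dense) (*ℕ→ℚ≤ℕ→ℚ⇒≤ β _ _ blue-dense))
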